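{- Let $k$ and $n$ be positive integers. Then, in the polynomial ring $\mathbb{Z}[x_1,\dots,x_n]$, \[e_{k,n}(x) = \sum_{i=1}^{k} (-1)^{i+1} h_{i,n-i+1}(x)\, e_{k-i,n-i}(x).\]
   Context: For integers $j \ge 0$ and $m$, the elementary symmetric polynomial is $e_{j,m}(x)=\sum_{1\le i_1<\dots<i_j\le m} x_{i_1}\cdots x_{i_j}$, with the conventions $e_{j,m}=0$ whenever $m<j$ and $e_{0,m}=1$ for $m\ge 0$; the complete homogeneous symmetric polynomial is $h_{j,m}(x)=\sum_{1\le i_1\le\dots\le i_j\le m} x_{i_1}\cdots x_{i_j}$, with the conventions $h_{0,m}=1$ and $h_{j,m}=0$ when $j>0$ and $m\le 0$. -}

module Defs where

open import Data.Nat using (ℕ; zero; suc; _∸_)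
open import Data.Integer using (ℤ; +_; -[1+_])
open import Data.List using (List; []; _∷_; _++_; map; foldr; _∷ʳ_)
open import Algebra.Bundles using (CommutativeRing)

-- Index tuples (0-based; index i stands for the variable x_{i+1}).

-- incr j m : all strictly increasing lists i₁ < … < i_j with entries in {0,…,m-1}
incr : ℕ → ℕ → List (List ℕ)
incr zero    m       = [] ∷ []
incr (suc j) zero    = []
incr (suc j) (suc m) = incr (suc j) m ++ map (_∷ʳ m) (incr j m)

-- wincr j m : all weakly increasing lists i₁ ≤ … ≤ i_j with entries in {0,…,m-1}
wincr : ℕ → ℕ → List (List ℕ)
wincr zero    m       = [] ∷ []
wincr (suc j) zero    = []
wincr (suc j) (suc m) = wincr (suc j) m ++ map (_∷ʳ m) (wincr j (suc m))

module Sym {c ℓ} (R : CommutativeRing c ℓ) where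
  open CommutativeRing R

  sumR : List Carrier → Carrier
  sumR = foldr _+_ 0#

  mon : (ℕ → Carrier) → List ℕ → Carrier
  mon x is = foldr (λ i r → x i * r) 1# is

  -- e_{j,m}(x); equals 0 when m < j (incl. all m < 0), and e_{0,m} = 1 for m ≥ 0
  e : ℕ → ℤ → (ℕ → Carrier) → Carrier
  e j (+ m)      x = sumR (map (mon x) (incr j m))
  e j -[1+ m ]   x = 0#

  -- h_{j,m}(x); h_{0,m} = 1, and h_{j,m} = 0 for j > 0, m ≤ 0
  h : ℕ → ℤ → (ℕ → Carrier) → Carrier
  h j (+ m)          x = sumR (map (mon x) (wincr j m))
  h zero -[1+ m ]    x = 1#
  h (suc j) -[1+ m ] x = 0#

  sgn : ℕ → Carrier
  sgn zero    = 1#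
  sgn (suc i) = - sgn i

  sum1to : ℕ → (ℕ → Carrier) → Carrier
  sum1to zero    f = 0#
  sum1to (suc k) f = sum1to k f + f (suc k)

module Submission where

-- Write a_i(n) = h_{i,n-i+1} e_{k-i,n-i} for the i-th term (summand) and
-- d_i(n) = h_{i,n-i} e_{k-i,n-i} (diagonal). The recurrences
--   h_{i+1,m+1} = h_{i+1,m} + x_{m+1} h_{i,m+1},   e_{j+1,m+1} = e_{j+1,m} + x_{m+1} e_{j,m},
-- together with the conventions for m < 0, give a_{i+1}(n) + a_i(n-1) = d_{i+1}(n) + d_i(n)
-- for every integer n. The alternating sum S(n) therefore telescopes to
--   S(n) = d_0(n) - a_0(n-1) + S(n-1) + (-1)^{k+1} (d_k(n) - a_k(n-1)),
-- where d_0(n) = e_{k,n}, a_0(n-1) = e_{k,n-1} = S(n-1) by induction, and a_k(n-1) = d_k(n)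
-- since h_{k,n-k} vanishes whenever e_{0,n-k-1} does.

open import Defs
open import Data.Nat using (ℕ; suc; _∸_; _≤_)
open import Data.Integer as ℤ using (+_)
open import Algebra.Bundles using (CommutativeRing)

open import Data.Nat using (zero; _<_; s≤s)
open import Data.Nat.Properties using (+-∸-assoc; n∸n≡0; m<n⇒m<1+n; n<1+n)
open import Data.Integer using (ℤ; -[1+_])
import Data.Integer.Properties as ℤₚ
open import Data.Integer.Tactic.RingSolver using (solve-∀)
open import Data.List using ([]; _∷_; _++_; map; _∷ʳ_)
open import Data.List.Properties using (map-++)
open import Relation.Binary.PropositionalEquality as ≡ using (_≡_; cong; cong₂)
import Algebra.Properties.Ring as RingProperties
import Algebra.Solver.Ring.NaturalCoefficients.Default as NaturalCoefficientsSolver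
import Relation.Binary.Reasoning.Setoid as SetoidReasoning

module Sums {c ℓ} (R : CommutativeRing c ℓ) where
  open CommutativeRing R
  open Sym R
  open RingProperties ring using (-‿distribˡ-*)
  open SetoidReasoning setoid
  open NaturalCoefficientsSolver commutativeSemiring

  sumR-++ : ∀ xs ys → sumR (xs ++ ys) ≈ sumR xs + sumR ys
  sumR-++ []       ys = sym (+-identityˡ _)
  sumR-++ (a ∷ xs) ys = trans (+-congˡ (sumR-++ xs ys)) (sym (+-assoc _ _ _))

  alternatingSum : ℕ → (ℕ → Carrier) → Carrier
  alternatingSum K f = sum1to K (λ i → sgn (suc i) * f i)

  sgn-cancel : ∀ i y → sgn i * y + sgn (suc i) * y ≈ 0#
  sgn-cancel i y = begin
    sgn i * y + - sgn i * y    ≈⟨ +-congˡ (-‿distribˡ-* (sgn i) y) ⟨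
    sgn i * y + - (sgn i * y)  ≈⟨ -‿inverseʳ _ ⟩
    0#                         ∎

  alternatingSum-vanishes : ∀ K f → (∀ i → f (suc i) ≈ 0#) → alternatingSum K f ≈ 0#
  alternatingSum-vanishes zero    f f≈0 = refl
  alternatingSum-vanishes (suc K) f f≈0 = begin
    alternatingSum K f + sgn (suc (suc K)) * f (suc K)
      ≈⟨ +-cong (alternatingSum-vanishes K f f≈0) (*-congˡ (f≈0 K)) ⟩
    0# + sgn (suc (suc K)) * 0#  ≈⟨ +-identityˡ _ ⟩
    sgn (suc (suc K)) * 0#       ≈⟨ zeroʳ _ ⟩
    0#                           ∎

  alternatingSum-telescope : ∀ K (a b d : ℕ → Carrier) →
    (∀ i → i < K → a (suc i) + b i ≈ d (suc i) + d i) →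
    alternatingSum K a + (b 0 + sgn (suc K) * b K) ≈ d 0 + sgn (suc K) * d K + alternatingSum K b
  alternatingSum-telescope zero a b d _ = begin
    0# + (b 0 + sgn 1 * b 0)  ≈⟨ +-identityˡ _ ⟩
    b 0 + sgn 1 * b 0         ≈⟨ one-cancel (b 0) ⟩
    0#                        ≈⟨ one-cancel (d 0) ⟨
    d 0 + sgn 1 * d 0         ≈⟨ +-identityʳ _ ⟨
    d 0 + sgn 1 * d 0 + 0#    ∎
    where
    one-cancel : ∀ y → y + sgn 1 * y ≈ 0#
    one-cancel y = trans (+-congʳ (sym (*-identityˡ y))) (sgn-cancel 0 y)
  alternatingSum-telescope (suc K) a b d step = begin
    A + t * a K′ + (b 0 + t * b K′)
      ≈⟨ +-identityʳ _ ⟨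
    A + t * a K′ + (b 0 + t * b K′) + 0#
      ≈⟨ +-congˡ (sgn-cancel (suc K) (b K)) ⟨
    A + t * a K′ + (b 0 + t * b K′) + (s * b K + t * b K)
      ≈⟨ solve 7 (λ A a′ b₀ b′ bK s t →
                   A :+ t :* a′ :+ (b₀ :+ t :* b′) :+ (s :* bK :+ t :* bK)
                := A :+ (b₀ :+ s :* bK) :+ t :* (a′ :+ bK) :+ t :* b′)
                refl A (a K′) (b 0) (b K′) (b K) s t ⟩
    A + (b 0 + s * b K) + t * (a K′ + b K) + t * b K′
      ≈⟨ +-congʳ (+-cong (alternatingSum-telescope K a b d (λ i i<K → step i (m<n⇒m<1+n i<K)))
                         (*-congˡ (step K (n<1+n K)))) ⟩
    d 0 + s * d K + B + t * (d K′ + d K) + t * b K′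
      ≈⟨ solve 7 (λ d₀ dK d′ B b′ s t →
                   d₀ :+ s :* dK :+ B :+ t :* (d′ :+ dK) :+ t :* b′
                := d₀ :+ t :* d′ :+ (B :+ t :* b′) :+ (s :* dK :+ t :* dK))
                refl (d 0) (d K) (d K′) B (b K′) s t ⟩
    d 0 + t * d K′ + (B + t * b K′) + (s * d K + t * d K)
      ≈⟨ +-congˡ (sgn-cancel (suc K) (d K)) ⟩
    d 0 + t * d K′ + (B + t * b K′) + 0#
      ≈⟨ +-identityʳ _ ⟩
    d 0 + t * d K′ + (B + t * b K′) ∎
    where
    K′ = suc K
    A = alternatingSum K a
    B = alternatingSum K b
    s = sgn (suc K)
    t = sgn (suc K′)

module Recurrences {c ℓ} (R : CommutativeRing c ℓ) (x : ℕ → CommutativeRing.Carrier R) where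
  open CommutativeRing R
  open Sym R
  open Sums R using (sumR-++)
  open SetoidReasoning setoid
  open NaturalCoefficientsSolver commutativeSemiring

  mon-∷ʳ : ∀ is m → mon x (is ∷ʳ m) ≈ mon x is * x m
  mon-∷ʳ []       m = *-comm _ _
  mon-∷ʳ (i ∷ is) m = trans (*-congˡ (mon-∷ʳ is m)) (sym (*-assoc _ _ _))

  sumR-mon-∷ʳ : ∀ L m → sumR (map (mon x) (map (_∷ʳ m) L)) ≈ x m * sumR (map (mon x) L)
  sumR-mon-∷ʳ []      m = sym (zeroʳ _)
  sumR-mon-∷ʳ (l ∷ L) m = begin
    mon x (l ∷ʳ m) + sumR (map (mon x) (map (_∷ʳ m) L))
      ≈⟨ +-cong (trans (mon-∷ʳ l m) (*-comm _ _)) (sumR-mon-∷ʳ L m) ⟩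
    x m * mon x l + x m * sumR (map (mon x) L)
      ≈⟨ distribˡ _ _ _ ⟨
    x m * (mon x l + sumR (map (mon x) L)) ∎

  sumR-mon-split : ∀ A B m →
    sumR (map (mon x) (A ++ map (_∷ʳ m) B)) ≈ sumR (map (mon x) A) + x m * sumR (map (mon x) B)
  sumR-mon-split A B m = begin
    sumR (map (mon x) (A ++ map (_∷ʳ m) B))
      ≡⟨ cong sumR (map-++ (mon x) A (map (_∷ʳ m) B)) ⟩
    sumR (map (mon x) A ++ map (mon x) (map (_∷ʳ m) B))
      ≈⟨ sumR-++ (map (mon x) A) _ ⟩
    sumR (map (mon x) A) + sumR (map (mon x) (map (_∷ʳ m) B))
      ≈⟨ +-congˡ (sumR-mon-∷ʳ B m) ⟩
    sumR (map (mon x) A) + x m * sumR (map (mon x) B) ∎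

  e-suc : ∀ j m → e (suc j) (+ suc m) x ≈ e (suc j) (+ m) x + x m * e j (+ m) x
  e-suc j m = sumR-mon-split (incr (suc j) m) (incr j m) m

  h-suc : ∀ j m → h (suc j) (+ suc m) x ≈ h (suc j) (+ m) x + x m * h j (+ suc m) x
  h-suc j m = sumR-mon-split (wincr (suc j) m) (wincr j (suc m)) m

  h-zero : ∀ M → h 0 M x ≈ 1#
  h-zero (+ m)    = +-identityʳ 1#
  h-zero -[1+ m ] = refl

  e-no-variables : ∀ {j} → 1 ≤ j → e j (+ 0) x ≈ 0#
  e-no-variables (s≤s _) = refl

  h-e-exchange : ∀ i j M →
    h (suc i) (ℤ.suc M) x * e j M x + h i (ℤ.suc M) x * e (suc j) M x
      ≈ h (suc i) M x * e j M x + h i (ℤ.suc M) x * e (suc j) (ℤ.suc M) x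
  h-e-exchange i j (+ m) = begin
    h (suc i) (+ suc m) x * C + B * D
      ≈⟨ +-congʳ (*-congʳ (h-suc i m)) ⟩
    (A + x m * B) * C + B * D
      ≈⟨ solve 5 (λ A xm B C D → (A :+ xm :* B) :* C :+ B :* D := A :* C :+ B :* (D :+ xm :* C))
                 refl A (x m) B C D ⟩
    A * C + B * (D + x m * C)
      ≈⟨ +-congˡ (*-congˡ (e-suc j m)) ⟨
    A * C + B * e (suc j) (+ suc m) x ∎
    where
    A = h (suc i) (+ m) x
    B = h i (+ suc m) x
    C = e j (+ m) x
    D = e (suc j) (+ m) x
  h-e-exchange i j -[1+ zero ]  = refl
  h-e-exchange i j -[1+ suc m ] = refl

  h-e₀-shift : ∀ {j} → 1 ≤ j → ∀ M → h j (ℤ.suc M) x * e 0 M x ≈ h j (ℤ.suc M) x * e 0 (ℤ.suc M) x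
  h-e₀-shift (s≤s _) (+ m)         = refl
  h-e₀-shift (s≤s _) -[1+ zero ]   = trans (zeroˡ _) (sym (zeroˡ _))
  h-e₀-shift (s≤s _) -[1+ suc m ]  = refl

module AlternatingIdentity {c ℓ} (R : CommutativeRing c ℓ) (x : ℕ → CommutativeRing.Carrier R) (k : ℕ) where
  open CommutativeRing R
  open Sym R
  open Sums R
  open Recurrences R x
  open RingProperties ring using (+-cancelʳ)
  open SetoidReasoning setoid

  summand : ℤ → ℕ → Carrier
  summand N i = h i (N ℤ.- (+ i) ℤ.+ (+ 1)) x * e (k ∸ i) (N ℤ.- (+ i)) x

  diagonal : ℤ → ℕ → Carrier
  diagonal N i = h i (N ℤ.- + i) x * e (k ∸ i) (N ℤ.- + i) x

  summand-reindex : ∀ N i {M} → N ℤ.- + i ≡ M → summand N i ≡ h i (ℤ.suc M) x * e (k ∸ i) M x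
  summand-reindex N i ≡.refl = cong (λ L → h i L x * e (k ∸ i) (N ℤ.- + i) x) (ℤₚ.+-comm (N ℤ.- + i) (+ 1))

  h₀-times-e : ∀ L N → h 0 L x * e k (N ℤ.- + 0) x ≈ e k N x
  h₀-times-e L N = begin
    h 0 L x * e k (N ℤ.- + 0) x  ≈⟨ *-congʳ (h-zero L) ⟩
    1# * e k (N ℤ.- + 0) x       ≈⟨ *-identityˡ _ ⟩
    e k (N ℤ.- + 0) x            ≡⟨ cong (λ L → e k L x) (ℤₚ.+-identityʳ N) ⟩
    e k N x                      ∎

  summand-zero : ∀ N → summand N 0 ≈ e k N x
  summand-zero N = h₀-times-e (N ℤ.- + 0 ℤ.+ + 1) N

  diagonal-zero : ∀ N → diagonal N 0 ≈ e k N x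
  diagonal-zero N = h₀-times-e (N ℤ.- + 0) N

  summand-exchange : ∀ N i → i < k →
    summand (ℤ.suc N) (suc i) + summand N i ≈ diagonal (ℤ.suc N) (suc i) + diagonal (ℤ.suc N) i
  summand-exchange N i i<k = begin
    summand (ℤ.suc N) (suc i) + summand N i
      ≡⟨ cong₂ _+_ (summand-reindex (ℤ.suc N) (suc i) ≡.refl)
                   (≡.trans (summand-reindex N i (shift N (+ i)))
                            (cong (λ l → h i (ℤ.suc M) x * e l M x) k∸i≡1+j)) ⟩
    h (suc i) (ℤ.suc M) x * e j M x + h i (ℤ.suc M) x * e (suc j) M x
      ≈⟨ h-e-exchange i j M ⟩
    h (suc i) M x * e j M x + h i (ℤ.suc M) x * e (suc j) (ℤ.suc M) x
      ≡⟨ cong (λ y → h (suc i) M x * e j M x + y)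
              (cong₂ (λ l L → h i L x * e l L x) (≡.sym k∸i≡1+j) (≡.sym (suc-shift N (+ i)))) ⟩
    diagonal (ℤ.suc N) (suc i) + diagonal (ℤ.suc N) i ∎
    where
    M = ℤ.suc N ℤ.- + suc i
    j = k ∸ suc i
    k∸i≡1+j : k ∸ i ≡ suc j
    k∸i≡1+j = +-∸-assoc 1 i<k
    shift : ∀ N I → N ℤ.- I ≡ (+ 1 ℤ.+ N) ℤ.- (+ 1 ℤ.+ I)
    shift = solve-∀
    suc-shift : ∀ N I → (+ 1 ℤ.+ N) ℤ.- I ≡ + 1 ℤ.+ ((+ 1 ℤ.+ N) ℤ.- (+ 1 ℤ.+ I))
    suc-shift = solve-∀

  summand-last : 1 ≤ k → ∀ N → summand N k ≈ diagonal (ℤ.suc N) k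
  summand-last 1≤k N = begin
    summand N k
      ≡⟨ ≡.trans (summand-reindex N k ≡.refl) (cong (λ l → h k (ℤ.suc L) x * e l L x) (n∸n≡0 k)) ⟩
    h k (ℤ.suc L) x * e 0 L x
      ≈⟨ h-e₀-shift 1≤k L ⟩
    h k (ℤ.suc L) x * e 0 (ℤ.suc L) x
      ≡⟨ cong₂ (λ l L → h k L x * e l L x) (≡.sym (n∸n≡0 k)) (≡.sym (suc-sub N (+ k))) ⟩
    diagonal (ℤ.suc N) k ∎
    where
    L = N ℤ.- + k
    suc-sub : ∀ N K → (+ 1 ℤ.+ N) ℤ.- K ≡ + 1 ℤ.+ (N ℤ.- K)
    suc-sub = solve-∀

  alternating-identity : 1 ≤ k → ∀ n → e k (+ n) x ≈ alternatingSum k (summand (+ n))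
  alternating-identity 1≤k zero = begin
    e k (+ 0) x                       ≈⟨ e-no-variables 1≤k ⟩
    0#                                ≈⟨ alternatingSum-vanishes k (summand (+ 0)) (λ _ → zeroʳ _) ⟨
    alternatingSum k (summand (+ 0))  ∎
  alternating-identity 1≤k (suc n) = sym (+-cancelʳ C _ _ (begin
    alternatingSum k a + C
      ≈⟨ alternatingSum-telescope k a b d (summand-exchange (+ n)) ⟩
    d 0 + s * d k + alternatingSum k b
      ≈⟨ +-cong (+-cong (diagonal-zero (+ suc n)) (*-congˡ (sym (summand-last 1≤k (+ n)))))
                (sym (alternating-identity 1≤k n)) ⟩
    e k (+ suc n) x + s * b k + e k (+ n) x
      ≈⟨ +-assoc _ _ _ ⟩
    e k (+ suc n) x + (s * b k + e k (+ n) x)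
      ≈⟨ +-congˡ (+-comm _ _) ⟩
    e k (+ suc n) x + (e k (+ n) x + s * b k)
      ≈⟨ +-congˡ (+-congʳ (summand-zero (+ n))) ⟨
    e k (+ suc n) x + C ∎))
    where
    a = summand (+ suc n)
    b = summand (+ n)
    d = diagonal (+ suc n)
    s = sgn (suc k)
    C = b 0 + s * b k

proposition2 : ∀ {c ℓ} (R : CommutativeRing c ℓ) (k n : ℕ) → 1 ≤ k → 1 ≤ n →
    (x : ℕ → CommutativeRing.Carrier R) →
    let open CommutativeRing R in let open Sym R in
    e k (+ n) x ≈ sum1to k (λ i → sgn (suc i) * (h i ((+ n) ℤ.- (+ i) ℤ.+ (+ 1)) x * e (k ∸ i) ((+ n) ℤ.- (+ i)) x))
proposition2 R k n 1≤k _ x = alternating-identity 1≤k n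
  where open AlternatingIdentity R x k
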